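{- Let $\mathfrak{P}'$ be either $\mathfrak{P}$ or $\mathfrak{P}^*$, let $R\in\mathfrak{P}'$, and let $\mathcal{E}(R)$ be the EV-system of $R$ with respect to $\mathfrak{D}'=\mathfrak{P}'$. Then for all $\mathfrak{a},\mathfrak{b}\in\mathcal{E}_o(R)$, $$\mathfrak{a}\mathfrak{b}\in A(\mathcal{E}(R)^*)\iff \{\mathfrak{a}_1\}\cup\mathfrak{a}_2\subseteq\mathfrak{b}_2\ \text{ and }\ \{\mathfrak{b}_1\}\cup\mathfrak{b}_3\subseteq\mathfrak{a}_3.$$ Moreover, ERD and AID hold, i.e. $\mathcal{E}(R)\in\mathfrak{P}'$ and $\alpha^R_{\mathcal{E}(R),\phi_R}$ is the identity of $\mathcal{E}_o(R)$.
   Context: Digraphs $G=(V(G),A(G))$ have a finite nonempty vertex set, and $A(G)\subseteq V(G)\times V(G)$; loops are allowed. $G^*$ is $G$ with all loops removed. $N^{in}_G(v)=\{w\ne v: wv\in A(G)\}$ and $N^{out}_G(v)=\{w\neq v: vw\in A(G)\}$. A homomorphism maps arcs to arcs; it is strict if, in addition, it maps proper arcs to proper arcs. $\mathcal{S}(G,H)$ is the set of strict homomorphisms. $\mathfrak{P}$ is a representative system of the isomorphism classes of finite posets (reflexive, antisymmetric, transitive digraphs), and $\mathfrak{P}^*=\{P^*:P\in\mathfrak{P}\}$. Constructed digraphs are identified with their representatives. EV-system of $R$ with respect to $\mathfrak{D}'$: - Vertex set $\mathcal{E}_o(R)=\{(v,D,U):v\in V(R),\ D\subseteq N^{in}_R(v),\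 U\subseteq N^{out}_R(v)\}$, with components $\mathfrak{a}_1,\mathfrak{a}_2,\mathfrak{a}_3$. - $\phi_R(\mathfrak{a})=\mathfrak{a}_1$. - $\alpha^R_{G,\xi}(v)=(\xi(v),\xi[N^{in}_G(v)],\xi[N^{out}_G(v)])$ for $G\in\mathfrak{D}'$ and $\xi\in\mathcal{S}(G,R)$. - $\mathfrak{a}\mathfrak{b}\in A(\mathcal{E}(R))$ iff there exist $G\in\mathfrak{D}'$, $\xi\in\mathcal{S}(G,R)$ and $vw\in A(G)$ with $\mathfrak{a}=\alpha^R_{G,\xi}(v)$ and $\mathfrak{b}=\alpha^R_{G,\xi}(w)$. -}

module Defs where

open import Data.Nat using (ℕ)
open import Data.Fin using (Fin)
open import Data.Fin.Subset using (Subset; _∈_)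
open import Data.Bool using (Bool; T)
open import Data.Product using (Σ; ∃; _×_; _,_)
open import Data.Sum using (_⊎_)
open import Relation.Nullary using (¬_)
open import Relation.Binary.PropositionalEquality using (_≡_; _≢_)
open import Function.Bundles using (_⇔_)

record Digraph : Set₁ where
  field
    V : Set
    A : V → V → Set
open Digraph public

FinDigraph : ℕ → Set
FinDigraph n = Fin n → Fin n → Bool

⟦_⟧ : ∀ {n} → FinDigraph n → Digraph
⟦_⟧ {n} G = record { V = Fin n ; A = λ v w → T (G v w) }

_* : Digraph → Digraph
G * = record { V = V G ; A = λ a b → A G a b × a ≢ b }

refl-closure : Digraph → Digraph
refl-closure G = record { V = V G ; A = λ a b → a ≡ b ⊎ A G a b }

Nin : (G : Digraph) → V G → V G → Set
Nin G v w = w ≢ v × A G w v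

Nout : (G : Digraph) → V G → V G → Set
Nout G v w = w ≢ v × A G v w

record IsPoset (G : Digraph) : Set where
  field
    reflexive : ∀ a → A G a a
    antisym   : ∀ a b → A G a b → A G b a → a ≡ b
    trans     : ∀ a b c → A G a b → A G b c → A G a c

-- Members of 𝔓* : digraphs of the form P* with P a poset, i.e. loopless
-- digraphs whose reflexive closure is a poset.
IsPosetStar : Digraph → Set
IsPosetStar G = (∀ a → ¬ A G a a) × IsPoset (refl-closure G)

data Kind : Set where
  𝔓 𝔓* : Kind

InClass : Kind → Digraph → Set
InClass 𝔓  G = IsPoset G
InClass 𝔓* G = IsPosetStar G

record IsStrictHom (G H : Digraph) (ξ : V G → V H) : Set where
  field
    hom    : ∀ v w → A G v w → A H (ξ v) (ξ w)
    strict : ∀ v w → v ≢ w → A G v w → ξ v ≢ ξ w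

Image : ∀ {X Y : Set} → (X → Y) → (X → Set) → Y → Set
Image ξ S y = ∃ λ x → S x × ξ x ≡ y

-- Vertices of the EV-system: triples (v, D, U), D ⊆ N^in_R(v), U ⊆ N^out_R(v).
-- The subset conditions are irrelevant fields, so equality of vertices is
-- equality of the triples.
record Eo {n : ℕ} (R : FinDigraph n) : Set where
  constructor ⟨_,_,_⟩
  field
    a₁ : Fin n
    a₂ : Subset n
    a₃ : Subset n
    .a₂⊆ : ∀ u → u ∈ a₂ → Nin ⟦ R ⟧ a₁ u
    .a₃⊆ : ∀ u → u ∈ a₃ → Nout ⟦ R ⟧ a₁ u
open Eo public

φ : ∀ {n} {R : FinDigraph n} → Eo R → Fin n
φ = a₁

-- "α^R_{G,ξ}(v) = 𝔞", i.e. (ξ(v), ξ[N^in_G(v)], ξ[N^out_G(v)]) = 𝔞,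
-- with equality of subsets of Fin n read extensionally.
α≡ : ∀ {n} {R : FinDigraph n} (G : Digraph) (ξ : V G → Fin n) → V G → Eo R → Set
α≡ G ξ v 𝔞 =
  ξ v ≡ a₁ 𝔞
  × (∀ u → Image ξ (Nin G v) u ⇔ u ∈ a₂ 𝔞)
  × (∀ u → Image ξ (Nout G v) u ⇔ u ∈ a₃ 𝔞)

-- The EV-system 𝓔(R) with respect to 𝔇' = 𝔓' (given by its Kind).
-- Members of 𝔓' are represented (up to isomorphism) by finite digraphs on Fin m.
EV : Kind → ∀ {n} → FinDigraph n → Digraph
EV k {n} R = record
  { V = Eo R
  ; A = λ 𝔞 𝔟 →
      Σ ℕ λ m → Σ (FinDigraph m) λ G → InClass k ⟦ G ⟧ ×
      Σ (Fin m → Fin n) λ ξ → IsStrictHom ⟦ G ⟧ ⟦ R ⟧ ξ ×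
      Σ (Fin m) λ v → Σ (Fin m) λ w → T (G v w) × α≡ ⟦ G ⟧ ξ v 𝔞 × α≡ ⟦ G ⟧ ξ w 𝔟
  }

-- The forward direction only uses that a realising digraph G is a poset: if G has a proper arc v → w,
-- transitivity of G puts every proper in-neighbour of v (and v itself) below w, and dually, which is
-- exactly the condition 𝔞 ⊏ 𝔟 on 𝔞 = α(v) and 𝔟 = α(w). Conversely an arc 𝔞 → 𝔟 with 𝔞 ⊏ 𝔟 is realised
-- by the poset made of two three-layer chains a₂ 𝔞 < {a₁ 𝔞} < a₃ 𝔞 and a₂ 𝔟 < {a₁ 𝔟} < a₃ 𝔟, glued by
-- putting the lower half of the first below the upper half of the second; the inclusions in 𝔞 ⊏ 𝔟 say
-- that the gluing adds no neighbour to either centre. In 𝔓 a single such chain realises the loop at 𝔞.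
-- So the arcs of 𝓔(R) are the strict order ⊏ (plus loops in 𝔓), which gives ERD, and the vertices
-- (u, ∅, {a₁ 𝔞} ∪ a₃ 𝔞) and (u, {a₁ 𝔞} ∪ a₂ 𝔞, ∅) witness AID.
module Submission where

open import Defs
open import Data.Nat using (ℕ; _*_)
open import Data.Fin.Subset using (_∈_; _⊆_; _∪_; ⁅_⁆)
open import Data.Product using (_×_)
open import Function.Bundles using (_⇔_)

open import Data.Empty using (⊥-elim)
open import Data.Fin using (Fin) renaming (_≟_ to _≟ᶠ_)
open import Data.Fin.Patterns using (0F; 1F; 2F)
open import Data.Fin.Properties using (*↔×)
open import Data.Fin.Subset using (Subset) renaming (⊥ to ∅)
open import Data.Fin.Subset.Properties
  using (_∈?_; ∉⊥; ⊥⊆; ⊆-trans; ⊆-antisym; q⊆p∪q; x∈⁅x⁆; x∈⁅y⁆⇒x≡y; x∈p∪q⁺; x∈p∪q⁻)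
open import Data.Product using (∃-syntax; _,_; proj₁; proj₂; swap) renaming (map₁ to ×-map₁)
open import Data.Product.Function.NonDependent.Propositional using (_×-↔_)
open import Data.Sum using (_⊎_; inj₁; inj₂; [_,_]) renaming (map₁ to ⊎-map₁; map₂ to ⊎-map₂)
open import Function using (_∘_; id)
open import Function.Bundles using (_↔_; Inverse; Equivalence; mk⇔; mk↔ₛ′)
open import Function.Properties.Equivalence using () renaming (trans to ⇔-trans)
open import Function.Properties.Inverse using (↔-refl; ↔-trans)
open import Relation.Binary using (Decidable; Transitive)
open import Relation.Binary.PropositionalEquality
  using (_≡_; _≢_; refl; sym; trans; cong; subst; subst₂; ≢-sym)
open import Relation.Nullary using (¬_; Dec; yes; no)
open import Relation.Nullary.Decidable
  using (isYes; toWitness; fromWitness; map′; recompute; ¬?; T?; _×-dec_; _⊎-dec_)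

open Equivalence using (to; from)

-- Nin H v w unfolds to Proper H w v.
Proper : (H : Digraph) → V H → V H → Set
Proper H a b = a ≢ b × A H a b

Nout⇔Proper : ∀ (H : Digraph) {v w} → Nout H v w ⇔ Proper H v w
Nout⇔Proper _ = mk⇔ (×-map₁ ≢-sym) (×-map₁ ≢-sym)

Loop : Kind → {X : Set} → X → X → Set
Loop k a b = k ≡ 𝔓 × a ≡ b

loop? : ∀ k {m} (i j : Fin m) → Dec (Loop k i j)
loop? 𝔓  i j = map′ (refl ,_) proj₂ (i ≟ᶠ j)
loop? 𝔓* i j = no λ { (() , _) }

𝔓⇒reflexive : ∀ k {H} → InClass k H → k ≡ 𝔓 → ∀ a → A H a a
𝔓⇒reflexive 𝔓 H-poset refl = IsPoset.reflexive H-poset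

loop⇒𝔓 : ∀ k {H} → InClass k H → ∀ {a} → A H a a → k ≡ 𝔓
loop⇒𝔓 𝔓  _             _  = refl
loop⇒𝔓 𝔓* (loopless , _) aa = ⊥-elim (loopless _ aa)

proper-trans : ∀ k {H} → InClass k H → ∀ {a b c} → Proper H a b → Proper H b c → Proper H a c
proper-trans 𝔓 H-poset {a} {b} {c} (a≢b , ab) (_ , bc) =
  (λ { refl → a≢b (IsPoset.antisym H-poset a b ab bc) }) , IsPoset.trans H-poset a b c ab bc
proper-trans 𝔓* (loopless , H≤-poset) {a} {b} {c} (a≢b , ab) (_ , bc)
  with IsPoset.trans H≤-poset a b c (inj₂ ab) (inj₂ bc)
... | inj₁ refl = ⊥-elim (a≢b (IsPoset.antisym H≤-poset a b (inj₂ ab) (inj₂ bc)))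
... | inj₂ ac   = (λ { refl → loopless a ac }) , ac

isPoset-of-strict : ∀ {H : Digraph} {_<_ : V H → V H → Set} →
  (∀ {a} → ¬ a < a) → Transitive _<_ → (∀ a b → A H a b ⇔ (a ≡ b ⊎ a < b)) → IsPoset H
isPoset-of-strict {H} {_<_} <-irrefl <-trans arc⇔ = record
  { reflexive = λ a → from (arc⇔ a a) (inj₁ refl)
  ; antisym   = antisym
  ; trans     = transitive
  }
  where
  antisym : ∀ a b → A H a b → A H b a → a ≡ b
  antisym a b ab ba with to (arc⇔ a b) ab | to (arc⇔ b a) ba
  ... | inj₁ a≡b | _        = a≡b
  ... | inj₂ _   | inj₁ b≡a = sym b≡a
  ... | inj₂ a<b | inj₂ b<a = ⊥-elim (<-irrefl (<-trans a<b b<a))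
  transitive : ∀ a b c → A H a b → A H b c → A H a c
  transitive a b c ab bc with to (arc⇔ a b) ab | to (arc⇔ b c) bc
  ... | inj₁ refl | _         = bc
  ... | inj₂ _    | inj₁ refl = ab
  ... | inj₂ a<b  | inj₂ b<c  = from (arc⇔ a c) (inj₂ (<-trans a<b b<c))

inClass-of-strict : ∀ k {H : Digraph} {_<_ : V H → V H → Set} →
  (∀ {a} → ¬ a < a) → Transitive _<_ → (∀ a b → A H a b ⇔ (Loop k a b ⊎ a < b)) → InClass k H
inClass-of-strict 𝔓 <-irrefl <-trans arc⇔ = isPoset-of-strict <-irrefl <-trans λ a b →
  ⇔-trans (arc⇔ a b) (mk⇔ (⊎-map₁ proj₂) (⊎-map₁ (refl ,_)))
inClass-of-strict 𝔓* {H} {_<_} <-irrefl <-trans arc⇔ = loopless , isPoset-of-strict <-irrefl <-trans λ a b →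
  mk⇔ (⊎-map₂ (strict a b)) (⊎-map₂ (from (arc⇔ a b) ∘ inj₂))
  where
  strict : ∀ a b → A H a b → a < b
  strict a b ab = [ (λ { (() , _) }) , id ] (to (arc⇔ a b) ab)
  loopless : ∀ a → ¬ A H a a
  loopless a aa = <-irrefl (strict a a aa)

module StrictArcs {k : Kind} {H : Digraph} {_<_ : V H → V H → Set}
                  (<-irrefl : ∀ {a} → ¬ a < a) (<-trans : Transitive _<_)
                  (arc⇔ : ∀ a b → A H a b ⇔ (Loop k a b ⊎ a < b)) where

  proper⇔ : ∀ {a b} → Proper H a b ⇔ a < b
  proper⇔ {a} {b} = mk⇔ strict (λ a<b → (λ { refl → <-irrefl a<b }) , from (arc⇔ a b) (inj₂ a<b))
    where
    strict : Proper H a b → a < b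
    strict (a≢b , ab) = [ (λ loop → ⊥-elim (a≢b (proj₂ loop))) , id ] (to (arc⇔ a b) ab)

  loopless-arc⇔ : ∀ {a b} → A (H *) a b ⇔ a < b
  loopless-arc⇔ = mk⇔ (to proper⇔ ∘ swap) (swap ∘ from proper⇔)

  inClass : InClass k H
  inClass = inClass-of-strict k <-irrefl <-trans arc⇔

x∈⁅y⁆∪p⁻ : ∀ {n} {x y : Fin n} {p} → x ∈ ⁅ y ⁆ ∪ p → x ≡ y ⊎ x ∈ p
x∈⁅y⁆∪p⁻ {y = y} {p} = ⊎-map₁ (x∈⁅y⁆⇒x≡y y) ∘ x∈p∪q⁻ ⁅ y ⁆ p

⁅x⁆∪p⊆q⁺ : ∀ {n} {x : Fin n} {p q} → x ∈ q → p ⊆ q → ⁅ x ⁆ ∪ p ⊆ q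
⁅x⁆∪p⊆q⁺ x∈q p⊆q y∈ with x∈⁅y⁆∪p⁻ y∈
... | inj₁ refl = x∈q
... | inj₂ y∈p  = p⊆q y∈p

⁅x⁆∪p⊆q⇒x∈q : ∀ {n} {x : Fin n} {p q} → ⁅ x ⁆ ∪ p ⊆ q → x ∈ q
⁅x⁆∪p⊆q⇒x∈q {x = x} ⁅x⁆∪p⊆q = ⁅x⁆∪p⊆q (x∈p∪q⁺ (inj₁ (x∈⁅x⁆ x)))

module _ {n : ℕ} {R : FinDigraph n} where

  Eo-≡ : {𝔞 𝔟 : Eo R} → a₁ 𝔞 ≡ a₁ 𝔟 → a₂ 𝔞 ≡ a₂ 𝔟 → a₃ 𝔞 ≡ a₃ 𝔟 → 𝔞 ≡ 𝔟
  Eo-≡ {⟨ _ , _ , _ ⟩ _ _} {⟨ _ , _ , _ ⟩ _ _} refl refl refl = refl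

  α≡-unique : ∀ {H : Digraph} {ξ : V H → Fin n} {v} {𝔞 𝔟 : Eo R} →
    α≡ H ξ v 𝔞 → α≡ H ξ v 𝔟 → 𝔞 ≡ 𝔟
  α≡-unique (ξv≡a₁𝔞 , in𝔞 , out𝔞) (ξv≡a₁𝔟 , in𝔟 , out𝔟) =
    Eo-≡ (trans (sym ξv≡a₁𝔞) ξv≡a₁𝔟) (same-members in𝔞 in𝔟) (same-members out𝔞 out𝔟)
    where
    same-members : ∀ {P : Fin n → Set} {p q} → (∀ u → P u ⇔ u ∈ p) → (∀ u → P u ⇔ u ∈ q) → p ≡ q
    same-members P⇔p P⇔q =
      ⊆-antisym (λ {u} → to (P⇔q u) ∘ from (P⇔p u)) (λ {u} → to (P⇔p u) ∘ from (P⇔q u))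

  proper? : ∀ u v → Dec (Proper ⟦ R ⟧ u v)
  proper? u v = ¬? (u ≟ᶠ v) ×-dec T? (R u v)

  a₂-below : ∀ (𝔞 : Eo R) {u} → u ∈ a₂ 𝔞 → Proper ⟦ R ⟧ u (a₁ 𝔞)
  a₂-below (⟨ a , _ , _ ⟩ a₂⊆Nin _) {u} u∈ = recompute (proper? u a) (a₂⊆Nin u u∈)

  a₃-above : ∀ (𝔞 : Eo R) {u} → u ∈ a₃ 𝔞 → Proper ⟦ R ⟧ (a₁ 𝔞) u
  a₃-above (⟨ a , _ , _ ⟩ _ a₃⊆Nout) {u} u∈ =
    recompute (proper? a u) (to (Nout⇔Proper ⟦ R ⟧) (a₃⊆Nout u u∈))

  record _⊏_ (𝔞 𝔟 : Eo R) : Set where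
    constructor mk⊏
    field
      lower : ⁅ a₁ 𝔞 ⁆ ∪ a₂ 𝔞 ⊆ a₂ 𝔟
      upper : ⁅ a₁ 𝔟 ⁆ ∪ a₃ 𝔟 ⊆ a₃ 𝔞

  ⊏⇔ : ∀ {𝔞 𝔟} → 𝔞 ⊏ 𝔟 ⇔ (⁅ a₁ 𝔞 ⁆ ∪ a₂ 𝔞 ⊆ a₂ 𝔟 × ⁅ a₁ 𝔟 ⁆ ∪ a₃ 𝔟 ⊆ a₃ 𝔞)
  ⊏⇔ = mk⇔ (λ (mk⊏ lower upper) → lower , upper) (λ (lower , upper) → mk⊏ lower upper)

  ⊏-irrefl : ∀ {𝔞} → ¬ 𝔞 ⊏ 𝔞
  ⊏-irrefl {𝔞} (mk⊏ lower _) = proj₁ (a₂-below 𝔞 (⁅x⁆∪p⊆q⇒x∈q lower)) refl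

  ⊏-trans : Transitive _⊏_
  ⊏-trans (mk⊏ lower₁ upper₁) (mk⊏ lower₂ upper₂) =
    mk⊏ (⊆-trans lower₁ (⊆-trans (q⊆p∪q _ _) lower₂)) (⊆-trans upper₂ (⊆-trans (q⊆p∪q _ _) upper₁))

  α-mono : ∀ k {H : Digraph} → InClass k H → ∀ {ξ : V H → Fin n} {v w} {𝔞 𝔟 : Eo R} →
    α≡ H ξ v 𝔞 → α≡ H ξ w 𝔟 → Proper H v w → 𝔞 ⊏ 𝔟
  α-mono k {H} H-class {𝔞 = 𝔞} {𝔟} (ξv≡a₁𝔞 , in𝔞 , out𝔞) (ξw≡a₁𝔟 , in𝔟 , out𝔟) vw =
    mk⊏ (⁅x⁆∪p⊆q⁺ (to (in𝔟 _) (_ , vw , ξv≡a₁𝔞)) in-mono)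
        (⁅x⁆∪p⊆q⁺ (to (out𝔞 _) (_ , from (Nout⇔Proper H) vw , ξw≡a₁𝔟)) out-mono)
    where
    in-mono : a₂ 𝔞 ⊆ a₂ 𝔟
    in-mono {u} u∈ with from (in𝔞 u) u∈
    ... | x , xv , ξx≡u = to (in𝔟 u) (x , proper-trans k H-class xv vw , ξx≡u)
    out-mono : a₃ 𝔟 ⊆ a₃ 𝔞
    out-mono {u} u∈ with from (out𝔟 u) u∈
    ... | x , wx , ξx≡u =
      to (out𝔞 u) (x , from (Nout⇔Proper H) (proper-trans k H-class vw (to (Nout⇔Proper H) wx)) , ξx≡u)

record FinStrictOrder : Set₁ where
  field
    Carrier   : Set
    _<_       : Carrier → Carrier → Set
    _<?_      : Decidable _<_
    <-irrefl  : ∀ {x} → ¬ x < x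
    <-trans   : Transitive _<_
    size      : ℕ
    enumerate : Fin size ↔ Carrier

data Layer : Set where
  below centre above : Layer

data _<ᴸ_ : Layer → Layer → Set where
  below<centre : below <ᴸ centre
  centre<above : centre <ᴸ above
  below<above  : below <ᴸ above

_<ᴸ?_ : Decidable _<ᴸ_
below  <ᴸ? below  = no λ ()
below  <ᴸ? centre = yes below<centre
below  <ᴸ? above  = yes below<above
centre <ᴸ? below  = no λ ()
centre <ᴸ? centre = no λ ()
centre <ᴸ? above  = yes centre<above
above  <ᴸ? _      = no λ ()

<ᴸ-trans : Transitive _<ᴸ_
<ᴸ-trans below<centre centre<above = below<above
<ᴸ-trans centre<above ()
<ᴸ-trans below<above  ()

layers : FinStrictOrder
layers = record
  { Carrier   = Layer
  ; _<_       = _<ᴸ_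
  ; _<?_      = _<ᴸ?_
  ; <-irrefl  = λ ()
  ; <-trans   = <ᴸ-trans
  ; size      = 3
  ; enumerate = mk↔ₛ′ (λ { 0F → below ; 1F → centre ; 2F → above })
                      (λ { below → 0F ; centre → 1F ; above → 2F })
                      (λ { below → refl ; centre → refl ; above → refl })
                      (λ { 0F → refl ; 1F → refl ; 2F → refl })
  }

data Side : Set where
  src tgt : Side

data _≺_ : Side × Layer → Side × Layer → Set where
  within : ∀ {s i j} → i <ᴸ j → (s , i) ≺ (s , j)
  across : ∀ {i j} → i <ᴸ above → below <ᴸ j → (src , i) ≺ (tgt , j)

_≺?_ : Decidable _≺_
(src , i) ≺? (src , j) = map′ within (λ { (within i<j) → i<j }) (i <ᴸ? j)
(tgt , i) ≺? (tgt , j) = map′ within (λ { (within i<j) → i<j }) (i <ᴸ? j)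
(src , i) ≺? (tgt , j) =
  map′ (λ (i<above , below<j) → across i<above below<j) (λ { (across i<above below<j) → i<above , below<j })
       (i <ᴸ? above ×-dec below <ᴸ? j)
(tgt , _) ≺? (src , _) = no λ ()

≺-irrefl : ∀ {t} → ¬ t ≺ t
≺-irrefl (within ())

≺-trans : Transitive _≺_
≺-trans (within i<j) (within j<k)            = within (<ᴸ-trans i<j j<k)
≺-trans (within i<j) (across j<above below<k) = across (<ᴸ-trans i<j j<above) below<k
≺-trans (across i<above below<j) (within j<k) = across i<above (<ᴸ-trans below<j j<k)

twoSided : FinStrictOrder
twoSided = record
  { Carrier   = Side × Layer
  ; _<_       = _≺_
  ; _<?_      = _≺?_
  ; <-irrefl  = ≺-irrefl
  ; <-trans   = ≺-trans
  ; size      = 2 * 3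
  ; enumerate = ↔-trans *↔× (Fin2↔Side ×-↔ FinStrictOrder.enumerate layers)
  }
  where
  Fin2↔Side : Fin 2 ↔ Side
  Fin2↔Side = mk↔ₛ′ (λ { 0F → src ; 1F → tgt }) (λ { src → 0F ; tgt → 1F })
                    (λ { src → refl ; tgt → refl }) (λ { 0F → refl ; 1F → refl })

module EVSystem (k : Kind) {n : ℕ} (R : FinDigraph n) (R-class : InClass k ⟦ R ⟧) where

  module Realisation (P : FinStrictOrder) (ℓ : FinStrictOrder.Carrier P → Fin n)
    (ℓ-mono : ∀ {x y} → FinStrictOrder._<_ P x y → Proper ⟦ R ⟧ (ℓ x) (ℓ y)) where

    open FinStrictOrder P

    decode : Fin size → Carrier
    decode = Inverse.to enumerate

    encode : Carrier → Fin size
    encode = Inverse.from enumerate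

    decode-encode : ∀ x → decode (encode x) ≡ x
    decode-encode = Inverse.strictlyInverseˡ enumerate

    arc? : ∀ i j → Dec (Loop k i j ⊎ decode i < decode j)
    arc? i j = loop? k i j ⊎-dec (decode i <? decode j)

    G : FinDigraph size
    G i j = isYes (arc? i j)

    G-arc⇔ : ∀ i j → A ⟦ G ⟧ i j ⇔ (Loop k i j ⊎ decode i < decode j)
    G-arc⇔ i j = mk⇔ toWitness (fromWitness {a? = arc? i j})

    open StrictArcs {H = ⟦ G ⟧} {λ i j → decode i < decode j} <-irrefl <-trans G-arc⇔
      using (proper⇔; inClass)

    ξ : Fin size → Fin n
    ξ = ℓ ∘ decode

    ξ-strictHom : IsStrictHom ⟦ G ⟧ ⟦ R ⟧ ξ
    ξ-strictHom = record { hom = hom ; strict = λ i j i≢j ij → proj₁ (ℓ-mono (to proper⇔ (i≢j , ij))) }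
      where
      hom : ∀ i j → A ⟦ G ⟧ i j → A ⟦ R ⟧ (ξ i) (ξ j)
      hom i j ij with to (G-arc⇔ i j) ij
      ... | inj₁ (k≡𝔓 , refl) = 𝔓⇒reflexive k R-class k≡𝔓 (ξ i)
      ... | inj₂ i<j          = proj₂ (ℓ-mono i<j)

    record α<≡ (x : Carrier) (𝔞 : Eo R) : Set where
      field
        ℓ≡a₁   : ℓ x ≡ a₁ 𝔞
        below⇔ : ∀ u → Image ℓ (_< x) u ⇔ u ∈ a₂ 𝔞
        above⇔ : ∀ u → Image ℓ (x <_) u ⇔ u ∈ a₃ 𝔞

    image-decode : ∀ {P : Fin size → Set} {Q : Carrier → Set} → (∀ i → P i ⇔ Q (decode i)) →
      ∀ u → Image ξ P u ⇔ Image ℓ Q u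
    image-decode {Q = Q} P⇔Q u = mk⇔
      (λ (i , Pi , ξi≡u) → decode i , to (P⇔Q i) Pi , ξi≡u)
      (λ (x , Qx , ℓx≡u) → encode x ,
        from (P⇔Q (encode x)) (subst Q (sym (decode-encode x)) Qx) ,
        trans (cong ℓ (decode-encode x)) ℓx≡u)

    α-encode : ∀ {x 𝔞} → α<≡ x 𝔞 → α≡ ⟦ G ⟧ ξ (encode x) 𝔞
    α-encode {x} record { ℓ≡a₁ = ℓx≡a₁ ; below⇔ = below⇔ ; above⇔ = above⇔ } =
      trans (cong ℓ (decode-encode x)) ℓx≡a₁ ,
      (λ u → ⇔-trans (image-decode Nin-encode u) (below⇔ u)) ,
      (λ u → ⇔-trans (image-decode Nout-encode u) (above⇔ u))
      where
      Nin-encode : ∀ i → Nin ⟦ G ⟧ (encode x) i ⇔ decode i < x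
      Nin-encode i = subst (λ y → Proper ⟦ G ⟧ i (encode x) ⇔ decode i < y) (decode-encode x) proper⇔
      Nout-encode : ∀ i → Nout ⟦ G ⟧ (encode x) i ⇔ x < decode i
      Nout-encode i = ⇔-trans (Nout⇔Proper ⟦ G ⟧)
        (subst (λ y → Proper ⟦ G ⟧ (encode x) i ⇔ y < decode i) (decode-encode x) proper⇔)

    realise : ∀ {x y 𝔞 𝔟} → Loop k x y ⊎ x < y → α<≡ x 𝔞 → α<≡ y 𝔟 → A (EV k R) 𝔞 𝔟
    realise {x} {y} x→y αx αy =
      size , G , inClass , ξ , ξ-strictHom , encode x , encode y ,
      from (G-arc⇔ (encode x) (encode y)) (arc-encode x→y) , α-encode αx , α-encode αy
      where
      arc-encode : Loop k x y ⊎ x < y → Loop k (encode x) (encode y) ⊎ decode (encode x) < decode (encode y)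
      arc-encode (inj₁ (k≡𝔓 , refl)) = inj₁ (k≡𝔓 , refl)
      arc-encode (inj₂ x<y) = inj₂ (subst₂ _<_ (sym (decode-encode x)) (sym (decode-encode y)) x<y)

  module LabelledRealisation (P : FinStrictOrder) (S : FinStrictOrder.Carrier P → Subset n)
    (S-mono : ∀ {t u x y} → FinStrictOrder._<_ P t u → x ∈ S t → y ∈ S u → Proper ⟦ R ⟧ x y) where

    open FinStrictOrder P

    _⊏ˡ_ : Carrier × Fin n → Carrier × Fin n → Set
    (t , x) ⊏ˡ (u , y) = x ∈ S t × y ∈ S u × t < u

    labelled : FinStrictOrder
    labelled = record
      { Carrier   = Carrier × Fin n
      ; _<_       = _⊏ˡ_
      ; _<?_      = λ (t , x) (u , y) → x ∈? S t ×-dec y ∈? S u ×-dec t <? u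
      ; <-irrefl  = λ (_ , _ , t<t) → <-irrefl t<t
      ; <-trans   = λ (x∈ , _ , t<u) (_ , z∈ , u<v) → x∈ , z∈ , <-trans t<u u<v
      ; size      = size * n
      ; enumerate = ↔-trans *↔× (enumerate ×-↔ ↔-refl)
      }

    open Realisation labelled proj₂ (λ (x∈ , y∈ , t<u) → S-mono t<u x∈ y∈) public

    α-labelled : ∀ {t 𝔞} → a₁ 𝔞 ∈ S t →
      (∀ u → (∃[ s ] s < t × u ∈ S s) ⇔ u ∈ a₂ 𝔞) →
      (∀ u → (∃[ s ] t < s × u ∈ S s) ⇔ u ∈ a₃ 𝔞) →
      α<≡ (t , a₁ 𝔞) 𝔞
    α-labelled {t} a₁∈ below⇔ above⇔ = record
      { ℓ≡a₁   = refl
      ; below⇔ = λ u → ⇔-trans (mk⇔ (λ { ((s , _) , (u∈ , _ , s<t) , refl) → s , s<t , u∈ })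
                                    (λ (s , s<t , u∈) → (s , u) , (u∈ , a₁∈ , s<t) , refl)) (below⇔ u)
      ; above⇔ = λ u → ⇔-trans (mk⇔ (λ { ((s , _) , (_ , u∈ , t<s) , refl) → s , t<s , u∈ })
                                    (λ (s , t<s , u∈) → (s , u) , (a₁∈ , u∈ , t<s) , refl)) (above⇔ u)
      }

  layer : Eo R → Layer → Subset n
  layer 𝔞 below  = a₂ 𝔞
  layer 𝔞 centre = ⁅ a₁ 𝔞 ⁆
  layer 𝔞 above  = a₃ 𝔞

  layer-mono : ∀ 𝔞 {i j x y} → i <ᴸ j → x ∈ layer 𝔞 i → y ∈ layer 𝔞 j → Proper ⟦ R ⟧ x y
  layer-mono 𝔞 below<centre x∈ y∈ rewrite x∈⁅y⁆⇒x≡y _ y∈ = a₂-below 𝔞 x∈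
  layer-mono 𝔞 centre<above x∈ y∈ rewrite x∈⁅y⁆⇒x≡y _ x∈ = a₃-above 𝔞 y∈
  layer-mono 𝔞 below<above  x∈ y∈ = proper-trans k R-class (a₂-below 𝔞 x∈) (a₃-above 𝔞 y∈)

  lower⊆ : ∀ 𝔞 {i} → i <ᴸ above → layer 𝔞 i ⊆ ⁅ a₁ 𝔞 ⁆ ∪ a₂ 𝔞
  lower⊆ 𝔞 below<above  = x∈p∪q⁺ ∘ inj₂
  lower⊆ 𝔞 centre<above = x∈p∪q⁺ ∘ inj₁

  upper⊆ : ∀ 𝔞 {j} → below <ᴸ j → layer 𝔞 j ⊆ ⁅ a₁ 𝔞 ⁆ ∪ a₃ 𝔞
  upper⊆ 𝔞 below<centre = x∈p∪q⁺ ∘ inj₁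
  upper⊆ 𝔞 below<above  = x∈p∪q⁺ ∘ inj₂

  loop-realised : k ≡ 𝔓 → ∀ 𝔞 → A (EV k R) 𝔞 𝔞
  loop-realised k≡𝔓 𝔞 = realise (inj₁ (k≡𝔓 , refl)) α𝔞 α𝔞
    where
    open LabelledRealisation layers (layer 𝔞) (layer-mono 𝔞)
    α𝔞 : α<≡ (centre , a₁ 𝔞) 𝔞
    α𝔞 = α-labelled (x∈⁅x⁆ _)
      (λ u → mk⇔ (λ { (_ , below<centre , u∈) → u∈ }) (λ u∈ → below , below<centre , u∈))
      (λ u → mk⇔ (λ { (_ , centre<above , u∈) → u∈ }) (λ u∈ → above , centre<above , u∈))

  ⊏-realised : ∀ {𝔞 𝔟} → 𝔞 ⊏ 𝔟 → A (EV k R) 𝔞 𝔟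
  ⊏-realised {𝔞} {𝔟} (mk⊏ lower𝔞⊆a₂𝔟 upper𝔟⊆a₃𝔞) =
    realise (inj₂ (x∈⁅x⁆ _ , x∈⁅x⁆ _ , across centre<above below<centre)) α𝔞 α𝔟
    where
    endpoint : Side → Eo R
    endpoint src = 𝔞
    endpoint tgt = 𝔟
    S : Side × Layer → Subset n
    S (s , i) = layer (endpoint s) i
    S-mono : ∀ {t u x y} → t ≺ u → x ∈ S t → y ∈ S u → Proper ⟦ R ⟧ x y
    S-mono (within {s} i<j) = layer-mono (endpoint s) i<j
    S-mono (across i<above below<j) x∈ = layer-mono 𝔟 below<j (lower𝔞⊆a₂𝔟 (lower⊆ 𝔞 i<above x∈))
    open LabelledRealisation twoSided S S-mono
    α𝔞 : α<≡ ((src , centre) , a₁ 𝔞) 𝔞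
    α𝔞 = α-labelled (x∈⁅x⁆ _)
      (λ u → mk⇔ (λ { (_ , within below<centre , u∈) → u∈ }) (λ u∈ → _ , within below<centre , u∈))
      (λ u → mk⇔ (λ { (_ , within centre<above , u∈) → u∈
                    ; (_ , across _ below<j , u∈) → upper𝔟⊆a₃𝔞 (upper⊆ 𝔟 below<j u∈) })
                 (λ u∈ → _ , within centre<above , u∈))
    α𝔟 : α<≡ ((tgt , centre) , a₁ 𝔟) 𝔟
    α𝔟 = α-labelled (x∈⁅x⁆ _)
      (λ u → mk⇔ (λ { (_ , within below<centre , u∈) → u∈
                    ; (_ , across i<above _ , u∈) → lower𝔞⊆a₂𝔟 (lower⊆ 𝔞 i<above u∈) })
                 (λ u∈ → _ , within below<centre , u∈))
      (λ u → mk⇔ (λ { (_ , within centre<above , u∈) → u∈ }) (λ u∈ → _ , within centre<above , u∈))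

  EV-arc⇔ : ∀ 𝔞 𝔟 → A (EV k R) 𝔞 𝔟 ⇔ (Loop k 𝔞 𝔟 ⊎ 𝔞 ⊏ 𝔟)
  EV-arc⇔ 𝔞 𝔟 = mk⇔ classify realise-arc
    where
    classify : A (EV k R) 𝔞 𝔟 → Loop k 𝔞 𝔟 ⊎ 𝔞 ⊏ 𝔟
    classify (_ , G , G-class , ξ , _ , v , w , vw , α𝔞 , α𝔟) with v ≟ᶠ w
    ... | yes refl = inj₁ (loop⇒𝔓 k {⟦ G ⟧} G-class vw , α≡-unique {H = ⟦ G ⟧} α𝔞 α𝔟)
    ... | no v≢w   = inj₂ (α-mono k {⟦ G ⟧} G-class {ξ} {v} {w} α𝔞 α𝔟 (v≢w , vw))
    realise-arc : Loop k 𝔞 𝔟 ⊎ 𝔞 ⊏ 𝔟 → A (EV k R) 𝔞 𝔟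
    realise-arc (inj₁ (k≡𝔓 , refl)) = loop-realised k≡𝔓 𝔞
    realise-arc (inj₂ 𝔞⊏𝔟)         = ⊏-realised 𝔞⊏𝔟

  open StrictArcs ⊏-irrefl ⊏-trans EV-arc⇔ public

  ⁅a₁⁆∪a₃-above : ∀ 𝔞 {u w} → Proper ⟦ R ⟧ u (a₁ 𝔞) → w ∈ ⁅ a₁ 𝔞 ⁆ ∪ a₃ 𝔞 → Proper ⟦ R ⟧ u w
  ⁅a₁⁆∪a₃-above 𝔞 u<a₁ w∈ with x∈⁅y⁆∪p⁻ w∈
  ... | inj₁ refl = u<a₁
  ... | inj₂ w∈a₃ = proper-trans k R-class u<a₁ (a₃-above 𝔞 w∈a₃)

  ⁅a₁⁆∪a₂-below : ∀ 𝔞 {u w} → Proper ⟦ R ⟧ (a₁ 𝔞) u → w ∈ ⁅ a₁ 𝔞 ⁆ ∪ a₂ 𝔞 → Proper ⟦ R ⟧ w u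
  ⁅a₁⁆∪a₂-below 𝔞 a₁<u w∈ with x∈⁅y⁆∪p⁻ w∈
  ... | inj₁ refl = a₁<u
  ... | inj₂ w∈a₂ = proper-trans k R-class (a₂-below 𝔞 w∈a₂) a₁<u

  lower-vertex : ∀ 𝔞 {u} → u ∈ a₂ 𝔞 → Eo R
  lower-vertex 𝔞 {u} u∈ = ⟨ u , ∅ , ⁅ a₁ 𝔞 ⁆ ∪ a₃ 𝔞 ⟩ (λ _ → ⊥-elim ∘ ∉⊥)
    (λ _ → from (Nout⇔Proper ⟦ R ⟧) ∘ ⁅a₁⁆∪a₃-above 𝔞 (a₂-below 𝔞 u∈))

  upper-vertex : ∀ 𝔞 {u} → u ∈ a₃ 𝔞 → Eo R
  upper-vertex 𝔞 {u} u∈ = ⟨ u , ⁅ a₁ 𝔞 ⁆ ∪ a₂ 𝔞 , ∅ ⟩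
    (λ _ → ⁅a₁⁆∪a₂-below 𝔞 (a₃-above 𝔞 u∈)) (λ _ → ⊥-elim ∘ ∉⊥)

  α-identity : ∀ 𝔞 → α≡ (EV k R) φ 𝔞 𝔞
  α-identity 𝔞 = refl , (λ u → mk⇔ in-to in-from) , (λ u → mk⇔ out-to out-from)
    where
    in-to : ∀ {u} → Image φ (Nin (EV k R) 𝔞) u → u ∈ a₂ 𝔞
    in-to (𝔟 , 𝔟𝔞 , refl) = ⁅x⁆∪p⊆q⇒x∈q (_⊏_.lower (to proper⇔ 𝔟𝔞))
    in-from : ∀ {u} → u ∈ a₂ 𝔞 → Image φ (Nin (EV k R) 𝔞) u
    in-from u∈ = lower-vertex 𝔞 u∈ , from proper⇔ (mk⊏ (⁅x⁆∪p⊆q⁺ u∈ ⊥⊆) id) , refl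
    out-to : ∀ {u} → Image φ (Nout (EV k R) 𝔞) u → u ∈ a₃ 𝔞
    out-to (𝔟 , 𝔞𝔟 , refl) = ⁅x⁆∪p⊆q⇒x∈q (_⊏_.upper (to proper⇔ (to (Nout⇔Proper (EV k R)) 𝔞𝔟)))
    out-from : ∀ {u} → u ∈ a₃ 𝔞 → Image φ (Nout (EV k R) 𝔞) u
    out-from u∈ =
      upper-vertex 𝔞 u∈ , from (Nout⇔Proper (EV k R)) (from proper⇔ (mk⊏ id (⁅x⁆∪p⊆q⁺ u∈ ⊥⊆))) , refl

proposition4 : (k : Kind) (n : ℕ) (R : FinDigraph n) → InClass k ⟦ R ⟧ →
    (∀ (𝔞 𝔟 : Eo R) →
      A (EV k R *) 𝔞 𝔟 ⇔ ((⁅ a₁ 𝔞 ⁆ ∪ a₂ 𝔞) ⊆ a₂ 𝔟 × (⁅ a₁ 𝔟 ⁆ ∪ a₃ 𝔟) ⊆ a₃ 𝔞))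
    × InClass k (EV k R)
    × (∀ (𝔞 : Eo R) → α≡ (EV k R) φ 𝔞 𝔞)
proposition4 k n R R-class = (λ _ _ → ⇔-trans loopless-arc⇔ ⊏⇔) , inClass , α-identity
  where open EVSystem k R R-class
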